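{- Let $N=(P,T,E,s_0)$ be a 1-safe Petri net with processes $\mathcal{C}$ covering $T$, uncontrollable transitions $\mathit{uc}(T)\subseteq T$, a generalized invariant $I$, good states $G$ and safe transition relation $R$ as defined below. If $\pi\in\mathcal{C}$, $t\in\pi\cap\mathit{uc}(T)$ and $(s,t)\in R$, then $s\models K^w_\pi\varphi_{\mathit{good}(t)}$, i.e., for every $s'\in G$ with $s'\lceil_\pi=s\lceil_\pi$ we have $(s',t)\in R$.
   Context: A 1-safe Petri net is $N=(P,T,E,s_0)$ with $P$ a finite set of places, states being subsets of $P$, $s_0$ the initial state, $T$ finite, $E\subseteq(P\times T)\cup(T\times P)$. With ${}^\bullet t=\{p\mid(p,t)\in E\}$, $t^\bullet=\{p\mid(t,p)\in E\}$, $t$ is enabled in $s$ if ${}^\bullet t\subseteq s$ and $t^\bullet\cap s\subseteq{}^\bullet t$; firing gives $s'=(s\setminus{}^\bullet t)\cup t^\bullet$, written $s\xrightarrow{t}s'$. A deadlock is a state with no enabled transition. A process is a subset of $T$; $\mathcal{C}$ covers $T$. $\mathit{ngb}(\pi)=\bigcup_{t\in\pi}({}^\bullet t\cup t^\bullet)$ and $s\lceil_\pi=s\cap\mathit{ngb}(\pi)$. A generalized invariant is $I\subseteq 2^P\times T$. For $J\subseteq 2^P\times T$, $\mathit{reach}_J(N)$ is the set of states reachable from $s_0$ via firings $s\xrightarrow{t}s'$ with $(s,t)\in J$. Attractor: $s\in\mathit{attr}(A)$ iff $s\in A$; or some $t\in\mathit{uc}(T)$ is enabled in $s$ with $s\xrightarrow{t}s'$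 and ($s'\in A$ or $(s,t)\notin I$); or $s$ is not a deadlock and every enabled $t$ with $s\xrightarrow{t}s'$ and $(s,t)\in I$ has $s'\in A$. $\mathit{attr}^*(\emptyset)$ is the least fixpoint of iterating $\mathit{attr}$ from $\emptyset$. $I_G=\{(s,t)\in I\mid s\xrightarrow{t}s',\ s'\notin\mathit{attr}^*(\emptyset)\}$; $G=\mathit{reach}_{I_G}(N)$ if $s_0\notin\mathit{attr}^*(\emptyset)$, else $G=\emptyset$. The safe transition relation is $R=\{(s,t)\in I\mid \exists s'\ s\xrightarrow{t}s',\ s,s'\in G\}$, and $\varphi_{\mathit{good}(t)}$ is the state predicate "$(s,t)\in R$". Weak knowledge is evaluated over the good states: $s\models K^w_\pi\psi$ iff every $s'\in G$ with $s'\lceil_\pi=s\lceil_\pi$ satisfies $\psi$. -}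

module Defs where

open import Data.Nat using (ℕ)
import Data.Nat as ℕ
open import Data.Bool using (Bool; true; false; _∧_; _∨_)
open import Data.Fin using (Fin; zero; suc)
open import Data.Fin.Subset using (Subset; _∈_; _⊆_; _∩_; _∪_; _─_)
open import Data.Vec using (tabulate; lookup)
open import Data.List using (List)
import Data.List.Membership.Propositional as LM
open import Data.Product using (Σ; _×_; ∃; _,_)
open import Data.Sum using (_⊎_)
open import Relation.Nullary using (¬_)
open import Relation.Binary.PropositionalEquality using (_≡_)

anyFin : {m : ℕ} → (Fin m → Bool) → Bool
anyFin {ℕ.zero}  f = false
anyFin {ℕ.suc m} f = f zero ∨ anyFin (λ i → f (suc i))

-- A (1-safe) Petri net N = (P, T, E, s₀) with P = Fin nP, T = Fin nT.
-- The flow relation E ⊆ (P × T) ∪ (T × P) is given by its two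
-- characteristic functions.
record PetriNet : Set where
  field
    nP    : ℕ
    nT    : ℕ
    inE   : Fin nP → Fin nT → Bool
    outE  : Fin nT → Fin nP → Bool
    s₀    : Subset nP

module Net (N : PetriNet) where
  open PetriNet N public

  State : Set
  State = Subset nP

  Trans : Set
  Trans = Fin nT

  pre : Trans → State
  pre t = tabulate (λ p → inE p t)

  post : Trans → State
  post t = tabulate (λ p → outE t p)

  Enabled : State → Trans → Set
  Enabled s t = (pre t ⊆ s) × ((post t ∩ s) ⊆ pre t)

  fire : State → Trans → State
  fire s t = (s ─ pre t) ∪ post t

  Step : State → Trans → State → Set
  Step s t s' = Enabled s t × (s' ≡ fire s t)

  Deadlock : State → Set
  Deadlock s = (t : Trans) → ¬ Enabled s t

  Process : Set
  Process = Subset nT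

  ngb : Process → State
  ngb π = tabulate (λ p → anyFin (λ t → lookup π t ∧ (inE p t ∨ outE t p)))

  restrict : State → Process → State
  restrict s π = s ∩ ngb π

  Covers : List Process → Set
  Covers C = (t : Trans) → ∃ λ π → (π LM.∈ C) × (t ∈ π)

  -- The game setting: uncontrollable transitions uc(T) and a
  -- generalized invariant I ⊆ 2^P × T, given by characteristic functions.
  module Game (uc : Trans → Bool) (I : State → Trans → Bool) where

    InI : State → Trans → Set
    InI s t = I s t ≡ true

    IsUC : Trans → Set
    IsUC t = uc t ≡ true

    -- attr*(∅): the least fixpoint of attr, as an inductive predicate
    -- (the clause "s ∈ A" is subsumed at the fixpoint).
    data Attr* : State → Set where
      attr-uc  : ∀ {s} t s' → IsUC t → Step s t s' →
                 (Attr* s' ⊎ ¬ InI s t) → Attr* s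
      attr-all : ∀ {s} → ¬ Deadlock s →
                 (∀ t s' → Step s t s' → InI s t → Attr* s') → Attr* s

    InIG : State → Trans → Set
    InIG s t = InI s t × (∀ s' → Step s t s' → ¬ Attr* s')

    data ReachG : State → Set where
      reach-init : ReachG s₀
      reach-step : ∀ {s t s'} → ReachG s → InIG s t → Step s t s' → ReachG s'

    -- G = reach_{I_G}(N) if s₀ ∉ attr*(∅), else ∅
    Good : State → Set
    Good s = ¬ Attr* s₀ × ReachG s

    InR : State → Trans → Set
    InR s t = InI s t × ∃ λ s' → Step s t s' × Good s × Good s'

    Kw : Process → (State → Set) → State → Set
    Kw π ψ s = ∀ s' → Good s' → restrict s' π ≡ restrict s π → ψ s'

    φgood : Trans → State → Set
    φgood t s = InR s t

-- Enabledness of t only inspects the places of •t ∪ t•, which lie in ngb(π)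
-- when t ∈ π; so t is enabled in every good s' with s'⌈π = s⌈π. At a good
-- state an enabled uncontrollable transition must lie in I and lead outside
-- attr*(∅), for otherwise the state itself would belong to attr*(∅); its
-- firing is therefore an I_G-step, so it stays in G and is safe.
module Submission where

open import Defs
open import Data.Bool using (Bool; true; _∧_; _∨_; _≟_)
open import Data.Bool.Properties using (∨-zeroʳ)
open import Data.Fin using (Fin; zero; suc)
import Data.Fin.Subset as S
open import Data.Fin.Subset.Properties using (x∈p∩q⁺; x∈p∩q⁻)
open import Data.List using (List)
open import Data.List.Membership.Propositional using (_∈_)
open import Data.Nat using (ℕ)
open import Data.Product using (_,_; proj₁)
open import Data.Sum using (inj₁; inj₂)
open import Data.Vec using (tabulate)
open import Data.Vec.Properties using (lookup⇒[]=; []=⇒lookup; lookup∘tabulate)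
open import Relation.Binary.PropositionalEquality using (_≡_; refl; sym; trans; cong; subst)
open import Relation.Nullary using (¬_)
open import Relation.Nullary.Decidable using (decidable-stable)

anyFin⁺ : {m : ℕ} (f : Fin m → Bool) (i : Fin m) → f i ≡ true → anyFin f ≡ true
anyFin⁺ f zero    fi = cong (_∨ anyFin (λ j → f (suc j))) fi
anyFin⁺ f (suc i) fi = trans (cong (f zero ∨_) (anyFin⁺ (λ j → f (suc j)) i fi)) (∨-zeroʳ (f zero))

∈-tabulate⁻ : {n : ℕ} (f : Fin n → Bool) {p : Fin n} → p S.∈ tabulate f → f p ≡ true
∈-tabulate⁻ f {p} p∈ = trans (sym (lookup∘tabulate f p)) ([]=⇒lookup p∈)

∈-tabulate⁺ : {n : ℕ} (f : Fin n → Bool) {p : Fin n} → f p ≡ true → p S.∈ tabulate f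
∈-tabulate⁺ f {p} fp = lookup⇒[]= p (tabulate f) (trans (lookup∘tabulate f p) fp)

module _ (N : PetriNet) where
  open Net N

  ∈-ngb : ∀ {π t p} → t S.∈ π → (inE p t ∨ outE t p) ≡ true → p S.∈ ngb π
  ∈-ngb {π} {t} t∈π adjacent =
    ∈-tabulate⁺ _ (anyFin⁺ _ t (trans (cong (_∧ _) ([]=⇒lookup t∈π)) adjacent))

  pre⊆ngb : ∀ {π t} → t S.∈ π → pre t S.⊆ ngb π
  pre⊆ngb {π} {t} t∈π {p} p∈ = ∈-ngb {π} t∈π (cong (_∨ outE t p) (∈-tabulate⁻ _ p∈))

  post⊆ngb : ∀ {π t} → t S.∈ π → post t S.⊆ ngb π
  post⊆ngb {π} {t} t∈π {p} p∈ =
    ∈-ngb {π} t∈π (trans (cong (inE p t ∨_) (∈-tabulate⁻ _ p∈)) (∨-zeroʳ (inE p t)))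

  ∈-restrict-transport : ∀ {π p} {s s' : State} → restrict s π ≡ restrict s' π →
                         p S.∈ ngb π → p S.∈ s → p S.∈ s'
  ∈-restrict-transport {π} {s' = s'} eq p∈ngb p∈s =
    proj₁ (x∈p∩q⁻ s' (ngb π) (subst (_ S.∈_) eq (x∈p∩q⁺ (p∈s , p∈ngb))))

  Enabled-respects-restrict : ∀ {π t} {s s' : State} → t S.∈ π →
                              restrict s' π ≡ restrict s π → Enabled s t → Enabled s' t
  Enabled-respects-restrict {π} {t} {s} {s'} t∈π eq (pre⊆s , post∩s⊆pre) =
    pre⊆s' , post∩s'⊆pre
    where
    pre⊆s' : pre t S.⊆ s'
    pre⊆s' p∈ = ∈-restrict-transport {π} (sym eq) (pre⊆ngb t∈π p∈) (pre⊆s p∈)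

    post∩s'⊆pre : (post t S.∩ s') S.⊆ pre t
    post∩s'⊆pre p∈ with x∈p∩q⁻ (post t) s' p∈
    ... | p∈post , p∈s' =
      post∩s⊆pre (x∈p∩q⁺ (p∈post , ∈-restrict-transport {π} eq (post⊆ngb t∈π p∈post) p∈s'))

  module _ (uc : Trans → Bool) (I : State → Trans → Bool) where
    open Game uc I

    ReachG⇒¬Attr* : ¬ Attr* s₀ → ∀ {s} → ReachG s → ¬ Attr* s
    ReachG⇒¬Attr* s₀∉A reach-init                       = s₀∉A
    ReachG⇒¬Attr* s₀∉A (reach-step _ (_ , succ∉A) s→s') = succ∉A _ s→s'

    enabled-uc⇒InR : ∀ {s t} → IsUC t → Good s → Enabled s t → InR s t
    enabled-uc⇒InR {s} {t} t-uc good@(s₀∉A , reach-s) enabled =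
      inI , fire s t , step , good , (s₀∉A , reach-step reach-s (inI , succ∉A) step)
      where
      s∉A : ¬ Attr* s
      s∉A = ReachG⇒¬Attr* s₀∉A reach-s

      step : Step s t (fire s t)
      step = enabled , refl

      inI : InI s t
      inI = decidable-stable (I s t ≟ true) (λ ∉I → s∉A (attr-uc t _ t-uc step (inj₂ ∉I)))

      succ∉A : ∀ s' → Step s t s' → ¬ Attr* s'
      succ∉A s' s→s' s'∈A = s∉A (attr-uc t s' t-uc s→s' (inj₁ s'∈A))

mainTheorem5 : (N : PetriNet) → let open Net N in
    (C : List Process) → Covers C →
    (uc : Trans → Bool) → (I : State → Trans → Bool) → let open Game uc I in
    (π : Process) → π ∈ C → (t : Trans) → t S.∈ π → IsUC t →
    (s : State) → InR s t → Kw π (φgood t) s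
mainTheorem5 N _ _ uc I π _ t t∈π t-uc s (_ , _ , (enabled , _) , _) s' good eq =
  enabled-uc⇒InR N uc I t-uc good (Enabled-respects-restrict N t∈π eq enabled)
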